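{- Let $G=(V,E)$ be a connected simple graph with a set-valued metric $\Omega(-,-)$ taking values in subsets of a set $\Omega$, and an involution $v\mapsto -v$ on $V$ which is both equivariant and a graph automorphism of $G$. If $V$ contains an $\Omega$-accessible vertex $x_0$, then the diameter of $G$ is exactly $|\Omega|$.
   Context: A set-valued metric on $G$ is a function $\Omega(-,-):V\times V\to 2^\Omega$ with $\Omega(x,y)=\Omega(y,x)$, $|\Omega(x,y)|=1$ for every edge $\{x,y\}$, and $\Omega(x,z)=\Omega(x,y)\triangle\Omega(y,z)$ (symmetric difference) for all $x,y,z$. An involution $v\mapsto -v$ on $V$ is equivariant if $\Omega(x,-y)=\Omega\setminus\Omega(x,y)$ for all $x,y$; it is a graph automorphism if it maps edges to edges. A vertex $x_0$ is $\Omega$-accessible if $d_G(x_0,y)=|\Omega(x_0,y)|$ for every $y\in V$, where $d_G$ is graph distance. -}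

module Defs where

open import Data.Nat using (ℕ; zero; suc; _≤_)
open import Data.Bool using (_xor_)
open import Data.Vec using (zipWith)
open import Data.Fin.Subset using (Subset; ∁; ∣_∣)
open import Data.Product using (Σ; _×_; _,_)
open import Relation.Binary.PropositionalEquality using (_≡_)
open import Relation.Nullary using (¬_)

_△_ : ∀ {m} → Subset m → Subset m → Subset m
_△_ = zipWith _xor_

record SimpleGraph (V : Set) : Set₁ where
  field
    Adj      : V → V → Set
    adj-sym  : ∀ {x y} → Adj x y → Adj y x
    adj-irr  : ∀ {x} → ¬ Adj x x

module _ {V : Set} (G : SimpleGraph V) where
  open SimpleGraph G

  data Walk : V → V → ℕ → Set where
    nil  : ∀ {x} → Walk x x 0
    cons : ∀ {x y z n} → Adj x y → Walk y z n → Walk x z (suc n)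

  Connected : Set
  Connected = ∀ x y → Σ ℕ λ n → Walk x y n

  IsDist : V → V → ℕ → Set
  IsDist x y d = Walk x y d × (∀ n → Walk x y n → d ≤ n)

  HasDiameter : ℕ → Set
  HasDiameter D =
    (∀ x y → Σ ℕ λ n → n ≤ D × Walk x y n)
    × Σ V λ x → Σ V λ y → IsDist x y D

  -- Set-valued metric with values in subsets of Ω = Fin m.
  record SetValuedMetric (m : ℕ) : Set where
    field
      Ωd      : V → V → Subset m
      Ω-sym   : ∀ x y → Ωd x y ≡ Ωd y x
      Ω-edge  : ∀ x y → Adj x y → ∣ Ωd x y ∣ ≡ 1
      Ω-tri   : ∀ x y z → Ωd x z ≡ (Ωd x y △ Ωd y z)

  module _ {m : ℕ} (Ωm : SetValuedMetric m) where
    open SetValuedMetric Ωm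

    IsInvolution : (V → V) → Set
    IsInvolution neg = ∀ v → neg (neg v) ≡ v

    Equivariant : (V → V) → Set
    Equivariant neg = ∀ x y → Ωd x (neg y) ≡ ∁ (Ωd x y)

    IsGraphAut : (V → V) → Set
    IsGraphAut neg = ∀ x y → Adj x y → Adj (neg x) (neg y)

    Accessible : V → Set
    Accessible x₀ = ∀ y → IsDist x₀ y ∣ Ωd x₀ y ∣

-- Equivariance gives Ω(x₀, -x₀) = Ω \ Ω(x₀, x₀) = Ω, so accessibility of x₀ puts -x₀ at
-- distance exactly |Ω|. For the upper bound, a walk x → x₀ → y has length
-- |Ω(x₀,x)| + |Ω(x₀,y)|, and transporting accessibility along the involution gives a walk
-- x → -x₀ → y of length |Ω \ Ω(x₀,x)| + |Ω \ Ω(x₀,y)|. The two lengths add up to 2|Ω|,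
-- so one of them is at most |Ω|.
module Submission where

open import Defs
open import Data.Nat using (ℕ; suc; _+_; _∸_; _≤_)
open import Data.Nat.Properties
  using (≤-total; +-monoˡ-≤; +-cancelˡ-≤; m+[n∸m]≡n; +-commutativeSemigroup)
open import Algebra.Properties.CommutativeSemigroup +-commutativeSemigroup using (interchange)
open import Data.Bool.Properties using (xor-same)
open import Data.Vec using ([]; _∷_)
open import Data.Fin.Subset using (Subset; ⊥; ∁; ∣_∣)
open import Data.Fin.Subset.Properties using (∣p∣≤n; ∣⊥∣≡0; ∣∁p∣≡n∸∣p∣)
open import Data.Product using (Σ; _×_; _,_; proj₁)
open import Data.Sum using (_⊎_; inj₁; inj₂)
open import Relation.Binary.PropositionalEquality
  using (_≡_; refl; trans; cong; cong₂; subst; module ≡-Reasoning)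

∣p∣+∣∁p∣≡n : ∀ {n} (p : Subset n) → ∣ p ∣ + ∣ ∁ p ∣ ≡ n
∣p∣+∣∁p∣≡n p = trans (cong (∣ p ∣ +_) (∣∁p∣≡n∸∣p∣ p)) (m+[n∸m]≡n (∣p∣≤n p))

p△p≡⊥ : ∀ {n} (p : Subset n) → p △ p ≡ ⊥
p△p≡⊥ []      = refl
p△p≡⊥ (x ∷ p) = cong₂ _∷_ (xor-same x) (p△p≡⊥ p)

x+y≡m+m⇒x≤m⊎y≤m : ∀ {x y m} → x + y ≡ m + m → x ≤ m ⊎ y ≤ m
x+y≡m+m⇒x≤m⊎y≤m {x} {y} {m} eq with ≤-total x m
... | inj₁ x≤m = inj₁ x≤m
... | inj₂ m≤x = inj₂ (+-cancelˡ-≤ m y m (subst (m + y ≤_) eq (+-monoˡ-≤ y m≤x)))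

∣p∣+∣q∣≤n⊎∣∁p∣+∣∁q∣≤n : ∀ {n} (p q : Subset n) → ∣ p ∣ + ∣ q ∣ ≤ n ⊎ ∣ ∁ p ∣ + ∣ ∁ q ∣ ≤ n
∣p∣+∣q∣≤n⊎∣∁p∣+∣∁q∣≤n {n} p q = x+y≡m+m⇒x≤m⊎y≤m (begin
  (∣ p ∣ + ∣ q ∣) + (∣ ∁ p ∣ + ∣ ∁ q ∣)  ≡⟨ interchange (∣ p ∣) (∣ q ∣) (∣ ∁ p ∣) (∣ ∁ q ∣) ⟩
  (∣ p ∣ + ∣ ∁ p ∣) + (∣ q ∣ + ∣ ∁ q ∣)  ≡⟨ cong₂ _+_ (∣p∣+∣∁p∣≡n p) (∣p∣+∣∁p∣≡n q) ⟩
  n + n                                 ∎)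
  where open ≡-Reasoning

module _ {V : Set} {G : SimpleGraph V} where
  open SimpleGraph G

  _▷_ : ∀ {x y z n} → Walk G x y n → Adj y z → Walk G x z (suc n)
  nil      ▷ e = cons e nil
  cons f w ▷ e = cons f (w ▷ e)

  reverse : ∀ {x y n} → Walk G x y n → Walk G y x n
  reverse nil        = nil
  reverse (cons e w) = reverse w ▷ adj-sym e

  _++_ : ∀ {x y z n k} → Walk G x y n → Walk G y z k → Walk G x z (n + k)
  nil      ++ v = v
  cons e w ++ v = cons e (w ++ v)

  walk-via : ∀ {c x y a b} → Walk G c x a → Walk G c y b → Walk G x y (a + b)
  walk-via w v = reverse w ++ v

  map : (f : V → V) → (∀ x y → Adj x y → Adj (f x) (f y)) →
        ∀ {x y n} → Walk G x y n → Walk G (f x) (f y) n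
  map f f-adj nil        = nil
  map f f-adj (cons e w) = cons (f-adj _ _ e) (map f f-adj w)

module _ {V : Set} {G : SimpleGraph V} {m : ℕ} (Ωm : SetValuedMetric G m) where
  open SetValuedMetric Ωm

  Ωd-diagonal : ∀ x → Ωd x x ≡ ⊥
  Ωd-diagonal x = trans (Ω-tri x x x) (p△p≡⊥ (Ωd x x))

  ∣Ωd-x-neg-x∣≡m : ∀ {neg} → Equivariant G Ωm neg → ∀ x → ∣ Ωd x (neg x) ∣ ≡ m
  ∣Ωd-x-neg-x∣≡m {neg} equivariant x = begin
    ∣ Ωd x (neg x) ∣    ≡⟨ cong ∣_∣ (equivariant x x) ⟩
    ∣ ∁ (Ωd x x) ∣      ≡⟨ cong (λ p → ∣ ∁ p ∣) (Ωd-diagonal x) ⟩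
    ∣ ∁ (⊥ {n = m}) ∣   ≡⟨ ∣∁p∣≡n∸∣p∣ (⊥ {n = m}) ⟩
    m ∸ ∣ ⊥ {n = m} ∣   ≡⟨ cong (m ∸_) (∣⊥∣≡0 m) ⟩
    m                   ∎
    where open ≡-Reasoning

  module _ {neg : V → V} (involution : IsInvolution G Ωm neg)
           (equivariant : Equivariant G Ωm neg) (automorphism : IsGraphAut G Ωm neg)
           {x₀ : V} (accessible : Accessible G Ωm x₀) where

    walk-from-x₀ : ∀ y → Walk G x₀ y ∣ Ωd x₀ y ∣
    walk-from-x₀ y = proj₁ (accessible y)

    walk-from-neg-x₀ : ∀ y → Walk G (neg x₀) y ∣ ∁ (Ωd x₀ y) ∣
    walk-from-neg-x₀ y =
      subst (λ v → Walk G (neg x₀) v _) (involution y)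
        (map neg automorphism
          (subst (Walk G x₀ (neg y)) (cong ∣_∣ (equivariant x₀ y)) (walk-from-x₀ (neg y))))

    short-walk : ∀ x y → Σ ℕ λ n → n ≤ m × Walk G x y n
    short-walk x y with ∣p∣+∣q∣≤n⊎∣∁p∣+∣∁q∣≤n (Ωd x₀ x) (Ωd x₀ y)
    ... | inj₁ ≤m = _ , ≤m , walk-via (walk-from-x₀ x) (walk-from-x₀ y)
    ... | inj₂ ≤m = _ , ≤m , walk-via (walk-from-neg-x₀ x) (walk-from-neg-x₀ y)

proposition3p12 : {V : Set} (G : SimpleGraph V) → Connected G →
    (m : ℕ) (Ωm : SetValuedMetric G m) (neg : V → V) →
    IsInvolution G Ωm neg → Equivariant G Ωm neg → IsGraphAut G Ωm neg →
    (x₀ : V) → Accessible G Ωm x₀ →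
    HasDiameter G m
proposition3p12 G _ m Ωm neg involution equivariant automorphism x₀ accessible =
  short-walk Ωm involution equivariant automorphism accessible ,
  x₀ , neg x₀ ,
  subst (IsDist G x₀ (neg x₀)) (∣Ωd-x-neg-x∣≡m Ωm equivariant x₀) (accessible (neg x₀))
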